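{- If $T$ is a cubic caterpillar of order at least $4$, then $T$ is royal-zero.
   Context: For a positive integer $k$, let $[k]=\{1,\dots,k\}$ and let $\mathcal{P}^*([k])$ denote the set of the $2^k-1$ nonempty subsets of $[k]$. For a connected graph $G$ of order at least $3$, an edge coloring $c:E(G)\to\mathcal{P}^*([k])$ induces the vertex coloring $c'(v)=\bigcup_{e\in E_v}c(e)$, where $E_v$ is the set of edges incident with $v$. The coloring $c$ is a strong royal $k$-edge coloring if $c'$ is injective on $V(G)$. The strong royal index $\mathrm{sroy}(G)$ is the minimum $k$ for which $G$ has a strong royal $k$-edge coloring. A connected graph $G$ of order $n\ge 3$, where $k$ is the unique integer with $2^{k-1}\le n\le 2^k-1$, is royal-zero if $\mathrm{sroy}(G)=k$. A caterpillar is a tree whose removal of all end-vertices (leaves) yields a path; a tree is cubic if every vertex that is not an end-vertex has degree $3$. -}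

module Defs where

open import Data.Nat using (ℕ; zero; suc; _+_; _∸_; _^_; _≤_)
open import Data.Bool using (Bool; true; false; if_then_else_; T)
open import Data.Fin using (Fin)
open import Data.Fin.Subset using (Subset; ⋃; ⊥; Nonempty)
open import Data.List using (List; []; _∷_; _++_; map; allFin; last)
open import Data.Nat.ListAction using (sum)
open import Data.List.Membership.Propositional using (_∈_)
open import Data.List.Relation.Unary.Unique.Propositional using (Unique)
open import Data.List.Relation.Unary.Linked using (Linked)
open import Data.Product using (Σ; _×_; ∃; ∃-syntax; _,_)
open import Data.Sum using (_⊎_)
open import Data.Maybe using (just)
open import Function using (_⇔_)
open import Relation.Nullary using (¬_)
open import Relation.Binary.PropositionalEquality using (_≡_)

record Graph (n : ℕ) : Set where
  field
    adj     : Fin n → Fin n → Bool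
    sym     : ∀ u v → adj u v ≡ adj v u
    irrefl  : ∀ v → adj v v ≡ false
open Graph public

module _ {n : ℕ} (G : Graph n) where

  Adj : Fin n → Fin n → Set
  Adj u v = T (adj G u v)

  data Walk : Fin n → Fin n → Set where
    here : ∀ {v} → Walk v v
    step : ∀ {u w v} → Adj u w → Walk w v → Walk u v

  Connected : Set
  Connected = ∀ u v → Walk u v

  IsCycle : List (Fin n) → Set
  IsCycle [] = Data.Empty.⊥ where import Data.Empty
  IsCycle (v₀ ∷ []) = Data.Empty.⊥ where import Data.Empty
  IsCycle (v₀ ∷ v₁ ∷ []) = Data.Empty.⊥ where import Data.Empty
  IsCycle cyc@(v₀ ∷ v₁ ∷ v₂ ∷ rest) =
    Unique cyc × Linked Adj cyc × (∃[ w ] (last cyc ≡ just w × Adj w v₀))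

  Acyclic : Set
  Acyclic = ∀ cyc → ¬ IsCycle cyc

  IsTree : Set
  IsTree = Connected × Acyclic

  degree : Fin n → ℕ
  degree v = sum (map (λ u → if adj G v u then 1 else 0) (allFin n))

  IsLeaf : Fin n → Set
  IsLeaf v = degree v ≡ 1

  IsCubicTree : Set
  IsCubicTree = IsTree × (∀ v → ¬ IsLeaf v → degree v ≡ 3)

  Consecutive : List (Fin n) → Fin n → Fin n → Set
  Consecutive p u v = ∃[ xs ] ∃[ ys ] (p ≡ xs ++ u ∷ v ∷ ys ⊎ p ≡ xs ++ v ∷ u ∷ ys)

  -- deleting all end-vertices yields a path: the non-leaves can be listed
  -- without repetition as p so that two of them are adjacent iff consecutive in p
  LeavesRemovedIsPath : Set
  LeavesRemovedIsPath =
    Σ (List (Fin n)) λ p →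
      Unique p × (∀ v → (v ∈ p) ⇔ (¬ IsLeaf v)) ×
      (∀ u v → u ∈ p → v ∈ p → Adj u v ⇔ Consecutive p u v)

  IsCaterpillar : Set
  IsCaterpillar = IsTree × LeavesRemovedIsPath

  record EdgeColoring (k : ℕ) : Set where
    field
      col      : Fin n → Fin n → Subset k
      col-sym  : ∀ u v → col u v ≡ col v u
      col-ne   : ∀ u v → Adj u v → Nonempty (col u v)
  open EdgeColoring public

  induced : ∀ {k} → EdgeColoring k → Fin n → Subset k
  induced c v = ⋃ (map (λ u → if adj G v u then col c v u else ⊥) (allFin n))

  IsStrongRoyal : ∀ {k} → EdgeColoring k → Set
  IsStrongRoyal c = ∀ u v → induced c u ≡ induced c v → u ≡ v

  HasStrongRoyal : ℕ → Set
  HasStrongRoyal k = Σ (EdgeColoring k) IsStrongRoyal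

  SroyIs : ℕ → Set
  SroyIs k = 1 ≤ k × HasStrongRoyal k × (∀ j → 1 ≤ j → HasStrongRoyal j → k ≤ j)

  RoyalZero : Set
  RoyalZero = ∀ k → 1 ≤ k → 2 ^ (k ∸ 1) ≤ n → n ≤ 2 ^ k ∸ 1 → SroyIs k

module Submission where

-- Let k be such that 2^(k-1) ≤ n ≤ 2^k - 1 and write k = j + 1.
-- Lower bound: the n induced colours of a strong royal k'-edge colouring of
-- a graph without isolated vertices are distinct nonempty subsets of [k'],
-- so n < 2^k' and hence k ≤ k'.
-- Upper bound: let s₀ … s_{m-1} be the spine.  As sᵢ has degree 3, its leaves
-- are one pendant leaf, plus one extra leaf at s₀ and one at s_{m-1} (three
-- leaves in total when m = 1).  So n = 2m + 2, whence m + 2 ≤ 2^j.  With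
-- c = 2^j - m - 1 ≥ 1 and binary encodings enc(x) ⊆ [j], label sᵢ by
-- {0} ∪ enc(c+i+1), its pendant leaf by enc(c+i+1), the extra leaf at s₀ by
-- {0}, and the one at s_{m-1} by enc(c) ⊆ enc(c+m) = [j].  This labelling is
-- injective, adjacent labels meet, and each colour of a label occurs on a
-- neighbour; any such labelling is induced by c(uv) = f(u) ∩ f(v).

module ListFacts where

  open import Data.Nat using (ℕ; zero; suc; _≤_; _<_; z≤n; s≤s)
  open import Data.Nat.Properties using (module ≤-Reasoning)
  open import Data.Fin using (Fin)
  open import Data.Bool using (Bool; true; false; if_then_else_)
  open import Data.Bool.Properties using (T?)
  open import Data.Nat.ListAction using (sum)
  open import Data.List using (List; []; _∷_; _++_; length; map; filter; allFin; take; drop)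
  open import Data.List.Properties using (length-filter; length-tabulate)
  open import Data.List.Membership.Propositional using (_∈_)
  open import Data.List.Membership.Propositional.Properties using (∈-filter⁺; ∈-filter⁻; ∈-allFin; ∈-++⁺ʳ)
  open import Data.List.Membership.Propositional.Properties.WithK using (unique∧set⇒bag)
  open import Data.List.Membership.DecPropositional using () renaming (_∈?_ to member?)
  open import Data.List.Relation.Binary.BagAndSetEquality using (∼bag⇒↭)
  open import Data.List.Relation.Binary.Permutation.Propositional.Properties using (↭-length)
  open import Data.List.Relation.Unary.Any using (here; there)
  open import Data.List.Relation.Unary.All as All using (All; []; _∷_)
  open import Data.List.Relation.Unary.All.Properties using (map⁺)
  open import Data.List.Relation.Unary.AllPairs using ([]; _∷_)
  open import Data.List.Relation.Unary.Unique.Propositional using (Unique)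
  open import Data.List.Relation.Unary.Unique.Propositional.Properties using (filter⁺; allFin⁺)
  open import Data.Fin.Properties using () renaming (_≟_ to _≟ᶠ_)
  open import Data.Product using (proj₂)
  open import Data.Empty using (⊥-elim)
  open import Function using (_⇔_; mk⇔; _∘_)
  open import Relation.Nullary using (yes; no)
  open import Relation.Binary.Definitions using (DecidableEquality)
  open import Relation.Unary using (Decidable)
  open import Relation.Binary.PropositionalEquality

  sameLength : ∀ {A : Set} {xs ys : List A} → Unique xs → Unique ys →
               (∀ {x} → x ∈ xs ⇔ x ∈ ys) → length xs ≡ length ys
  sameLength uxs uys same = ↭-length (∼bag⇒↭ (unique∧set⇒bag uxs uys same))

  unique⇒length≤ : ∀ {n} {xs : List (Fin n)} → Unique xs → length xs ≤ n
  unique⇒length≤ {n} {xs} uxs = begin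
    length xs                         ≡⟨ same ⟩
    length (filter inXs? (allFin n))  ≤⟨ length-filter inXs? (allFin n) ⟩
    length (allFin n)                 ≡⟨ length-tabulate (λ i → i) ⟩
    n                                 ∎
    where
    open ≤-Reasoning
    inXs? : Decidable (_∈ xs)
    inXs? v = member? _≟ᶠ_ v xs
    same : length xs ≡ length (filter inXs? (allFin n))
    same = sameLength uxs (filter⁺ inXs? (allFin⁺ n))
             (mk⇔ (λ x∈ → ∈-filter⁺ inXs? (∈-allFin _) x∈) (proj₂ ∘ ∈-filter⁻ inXs? {xs = allFin n}))

  length≡1⇒same-member : ∀ {A : Set} {xs : List A} {x y : A} → length xs ≡ 1 → x ∈ xs → y ∈ xs → x ≡ y
  length≡1⇒same-member {xs = _ ∷ []} _ (here refl) (here refl) = refl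

  map-unique : ∀ {A B : Set} {f : A → B} (g : B → A) {xs : List A} →
               (∀ {x} → x ∈ xs → g (f x) ≡ x) → Unique xs → Unique (map f xs)
  map-unique g inv [] = []
  map-unique {f = f} g {x ∷ xs} inv (x∉xs ∷ uxs) =
    map⁺ (All.tabulate distinct) ∷ map-unique g (inv ∘ there) uxs
    where
    distinct : ∀ {y} → y ∈ xs → f x ≢ f y
    distinct {y} y∈xs fx≡fy =
      All.lookup x∉xs y∈xs (trans (sym (inv (here refl))) (trans (cong g fx≡fy) (inv (there y∈xs))))

  sum-indicator : ∀ {A : Set} (b : A → Bool) xs →
    sum (map (λ u → if b u then 1 else 0) xs) ≡ length (filter (λ u → T? (b u)) xs)
  sum-indicator b [] = refl
  sum-indicator b (x ∷ xs) with b x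
  ... | true  = cong suc (sum-indicator b xs)
  ... | false = sum-indicator b xs

  module Positions {A : Set} (_≟_ : DecidableEquality A) (default : A) where

    at : List A → ℕ → A
    at []       _       = default
    at (y ∷ ys) zero    = y
    at (y ∷ ys) (suc i) = at ys i

    position : A → List A → ℕ
    position x [] = 0
    position x (y ∷ ys) with x ≟ y
    ... | yes _ = 0
    ... | no  _ = suc (position x ys)

    at-position : ∀ {x} xs → x ∈ xs → at xs (position x xs) ≡ x
    at-position {x} (y ∷ ys) x∈ with x ≟ y | x∈
    ... | yes x≡y | _         = sym x≡y
    ... | no  x≢y | here x≡y  = ⊥-elim (x≢y x≡y)
    ... | no  _   | there x∈′ = at-position ys x∈′

    position< : ∀ {x} xs → x ∈ xs → position x xs < length xs
    position< {x} (y ∷ ys) x∈ with x ≟ y | x∈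
    ... | yes _   | _         = s≤s z≤n
    ... | no  x≢y | here x≡y  = ⊥-elim (x≢y x≡y)
    ... | no  _   | there x∈′ = s≤s (position< ys x∈′)

    at∈ : ∀ xs {i} → i < length xs → at xs i ∈ xs
    at∈ (y ∷ ys) {zero}  _       = here refl
    at∈ (y ∷ ys) {suc i} (s≤s i<) = there (at∈ ys i<)

    position-injective : ∀ {x y} xs → x ∈ xs → y ∈ xs → position x xs ≡ position y xs → x ≡ y
    position-injective xs x∈ y∈ eq =
      trans (sym (at-position xs x∈)) (trans (cong (at xs) eq) (at-position xs y∈))

    position-head : ∀ x xs → position x (x ∷ xs) ≡ 0
    position-head x xs with x ≟ x
    ... | yes _   = refl
    ... | no  x≢x = ⊥-elim (x≢x refl)

    position-skip : ∀ {x y} ys → x ≢ y → position x (y ∷ ys) ≡ suc (position x ys)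
    position-skip {x} {y} ys x≢y with x ≟ y
    ... | yes x≡y = ⊥-elim (x≢y x≡y)
    ... | no  _   = refl

    position-at : ∀ xs {i} → Unique xs → i < length xs → position (at xs i) xs ≡ i
    position-at (y ∷ ys) {zero}  _            _        = position-head y ys
    position-at (y ∷ ys) {suc i} (y∉ys ∷ uys) (s≤s i<) =
      trans (position-skip ys (λ e → All.lookup y∉ys (at∈ ys i<) (sym e))) (cong suc (position-at ys uys i<))

    consecutive-positions : ∀ xs {u v ys} → Unique (xs ++ u ∷ v ∷ ys) →
      position v (xs ++ u ∷ v ∷ ys) ≡ suc (position u (xs ++ u ∷ v ∷ ys))
    consecutive-positions [] {u} {v} {ys} ((u≢v ∷ _) ∷ _) = begin
      position v (u ∷ v ∷ ys)   ≡⟨ position-skip (v ∷ ys) (u≢v ∘ sym) ⟩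
      suc (position v (v ∷ ys)) ≡⟨ cong suc (position-head v ys) ⟩
      1                         ≡⟨ cong suc (position-head u (v ∷ ys)) ⟨
      suc (position u (u ∷ v ∷ ys)) ∎
      where open ≡-Reasoning
    consecutive-positions (x ∷ xs) {u} {v} {ys} (x∉ ∷ uxs) = begin
      position v (x ∷ zs)       ≡⟨ position-skip zs (differs (there (here refl))) ⟩
      suc (position v zs)       ≡⟨ cong suc (consecutive-positions xs uxs) ⟩
      suc (suc (position u zs)) ≡⟨ cong suc (position-skip zs (differs (here refl))) ⟨
      suc (position u (x ∷ zs)) ∎
      where
      open ≡-Reasoning
      zs : List A
      zs = xs ++ u ∷ v ∷ ys
      differs : ∀ {w} → w ∈ u ∷ v ∷ ys → w ≢ x
      differs w∈ w≡x = All.lookup x∉ (∈-++⁺ʳ xs w∈) (sym w≡x)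

    split-at : ∀ xs {i} → suc i < length xs → xs ≡ take i xs ++ at xs i ∷ at xs (suc i) ∷ drop (suc (suc i)) xs
    split-at (x ∷ y ∷ xs) {zero}  _        = refl
    split-at (x ∷ xs)     {suc i} (s≤s i<) = cong (x ∷_) (split-at xs i<)

  member⇒nonempty : ∀ {A : Set} {x : A} {xs} → x ∈ xs → 0 < length xs
  member⇒nonempty (here _)  = s≤s z≤n
  member⇒nonempty (there _) = s≤s z≤n

module SubsetCodes where

  open import Data.Nat using (ℕ; zero; suc; _+_; _*_; _^_; _≤_; _<_; z≤n; s≤s)
  open import Data.Nat.Properties using (+-suc; <-trans; n<1+n; suc-injective; <⇒≢)
  open import Data.Bool using (Bool; true; false)
  open import Data.Fin using (Fin; toℕ; fromℕ<)
  open import Data.Fin.Properties using (toℕ-fromℕ<; injective⇒≤)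
  open import Data.Fin.Subset using (Subset; ⊥; ⊤; Nonempty)
  open import Data.Fin.Subset.Properties using (Empty-unique; nonempty?)
  open import Data.Vec using ([]; _∷_)
  open import Data.Empty using (⊥-elim)
  open import Relation.Nullary using (yes; no)
  open import Relation.Binary.PropositionalEquality

  bit : Bool → ℕ
  bit true  = 1
  bit false = 0

  double : ℕ → ℕ
  double zero    = zero
  double (suc x) = suc (suc (double x))

  double≡2* : ∀ x → double x ≡ 2 * x
  double≡2* zero    = refl
  double≡2* (suc x) = cong suc (trans (cong suc (double≡2* x)) (sym (+-suc x (x + 0))))

  2^-suc : ∀ k → 2 ^ suc k ≡ double (2 ^ k)
  2^-suc k = sym (double≡2* (2 ^ k))

  -- the binary value of a subset of [k], read as a bit vector with the least
  -- significant bit first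
  value : ∀ {k} → Subset k → ℕ
  value []      = 0
  value (b ∷ s) = bit b + double (value s)

  parity : ℕ → Bool
  parity zero          = false
  parity (suc zero)    = true
  parity (suc (suc x)) = parity x

  half : ℕ → ℕ
  half zero          = zero
  half (suc zero)    = zero
  half (suc (suc x)) = suc (half x)

  parity-bit : ∀ b x → parity (bit b + double x) ≡ b
  parity-bit true  zero    = refl
  parity-bit false zero    = refl
  parity-bit true  (suc x) = parity-bit true x
  parity-bit false (suc x) = parity-bit false x

  half-bit : ∀ b x → half (bit b + double x) ≡ x
  half-bit true  zero    = refl
  half-bit false zero    = refl
  half-bit true  (suc x) = cong suc (half-bit true x)
  half-bit false (suc x) = cong suc (half-bit false x)

  bit-half : ∀ x → bit (parity x) + double (half x) ≡ x
  bit-half zero          = refl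
  bit-half (suc zero)    = refl
  bit-half (suc (suc x)) = begin
    bit (parity x) + suc (suc (double (half x))) ≡⟨ +-suc (bit (parity x)) _ ⟩
    suc (bit (parity x) + suc (double (half x))) ≡⟨ cong suc (+-suc (bit (parity x)) _) ⟩
    suc (suc (bit (parity x) + double (half x))) ≡⟨ cong (λ y → suc (suc y)) (bit-half x) ⟩
    suc (suc x)                                  ∎
    where open ≡-Reasoning

  encode : ∀ k → ℕ → Subset k
  encode zero    _ = []
  encode (suc k) x = parity x ∷ encode k (half x)

  encode-value : ∀ {k} (s : Subset k) → encode k (value s) ≡ s
  encode-value []      = refl
  encode-value (b ∷ s) = cong₂ _∷_ (parity-bit b (value s))
                                   (trans (cong (encode _) (half-bit b (value s))) (encode-value s))

  value-injective : ∀ {k} {s t : Subset k} → value s ≡ value t → s ≡ t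
  value-injective {s = s} {t} eq = trans (sym (encode-value s)) (trans (cong (encode _) eq) (encode-value t))

  double-< : ∀ {x y} → x < y → suc (double x) < double y
  double-< {zero}  {suc y} _         = s≤s (s≤s z≤n)
  double-< {suc x} {suc y} (s≤s x<y) = s≤s (s≤s (double-< x<y))

  value< : ∀ {k} (s : Subset k) → value s < 2 ^ k
  value< []              = s≤s z≤n
  value< {suc k} (true  ∷ s) = subst (suc (double (value s)) <_) (sym (2^-suc k)) (double-< (value< s))
  value< {suc k} (false ∷ s) = subst (double (value s) <_) (sym (2^-suc k)) (<-trans (n<1+n _) (double-< (value< s)))

  half< : ∀ x y → x < double y → half x < y
  half< zero          (suc y) _                 = s≤s z≤n
  half< (suc zero)    (suc y) _                 = s≤s z≤n
  half< (suc (suc x)) (suc y) (s≤s (s≤s x<2y)) = s≤s (half< x y x<2y)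

  value-encode : ∀ k {x} → x < 2 ^ k → value (encode k x) ≡ x
  value-encode zero    {zero} _ = refl
  value-encode zero    {suc x} (s≤s ())
  value-encode (suc k) {x} x< =
    trans (cong (λ y → bit (parity x) + double y) (value-encode k (half< x (2 ^ k) (subst (x <_) (2^-suc k) x<))))
          (bit-half x)

  encode-injective : ∀ k {x y} → x < 2 ^ k → y < 2 ^ k → encode k x ≡ encode k y → x ≡ y
  encode-injective k {x} {y} x< y< eq = trans (sym (value-encode k x<)) (trans (cong value eq) (value-encode k y<))

  value-⊥ : ∀ {k} → value (⊥ {k}) ≡ 0
  value-⊥ {zero}  = refl
  value-⊥ {suc k} = cong double (value-⊥ {k})

  value-⊤ : ∀ {k} → suc (value (⊤ {k})) ≡ 2 ^ k
  value-⊤ {zero}  = refl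
  value-⊤ {suc k} = trans (cong double (value-⊤ {k})) (sym (2^-suc k))

  encode-nonempty : ∀ k {x} → 0 < x → x < 2 ^ k → Nonempty (encode k x)
  encode-nonempty k {x} 0<x x< with nonempty? (encode k x)
  ... | yes ne    = ne
  ... | no  empty = ⊥-elim (<⇒≢ 0<x (sym x≡0))
    where
    x≡0 : x ≡ 0
    x≡0 = trans (sym (value-encode k x<)) (trans (cong value (Empty-unique empty)) (value-⊥ {k}))

  encode-⊤ : ∀ k {x} → suc x ≡ 2 ^ k → encode k x ≡ ⊤
  encode-⊤ k eq = trans (cong (encode k) (suc-injective (trans eq (sym (value-⊤ {k}))))) (encode-value (⊤ {k}))

  subsets-bound : ∀ {m k} {f : Fin m → Subset k} → (∀ {i j} → f i ≡ f j → i ≡ j) → m ≤ 2 ^ k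
  subsets-bound {f = f} f-inj = injective⇒≤ {f = λ i → fromℕ< (value< (f i))} λ {i} {j} eq →
    f-inj (value-injective (trans (sym (toℕ-fromℕ< (value< (f i)))) (trans (cong toℕ eq) (toℕ-fromℕ< (value< (f j))))))

module RoyalColourings where

  open import Defs hiding (sym)
  open SubsetCodes
  open import Data.Nat using (ℕ; suc; _^_; _≤_)
  open import Data.Bool using (Bool; true; false; T; if_then_else_)
  open import Data.Fin using (Fin; zero; suc)
  open import Data.Fin.Subset using (Subset; _∈_; ⊥; Nonempty; _⊆_; _∩_; ⋃)
  open import Data.Fin.Subset.Properties using (∉⊥; x∈p∪q⁻; x∈p∪q⁺; x∈p∩q⁺; x∈p∩q⁻; ∩-comm; ⊆-antisym)
  open import Data.List using (List; []; _∷_; map; allFin)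
  open import Data.List.Membership.Propositional using () renaming (_∈_ to _∈ˡ_)
  open import Data.List.Membership.Propositional.Properties using (∈-map⁺; ∈-map⁻; ∈-allFin)
  open import Data.List.Relation.Unary.Any using (here; there)
  open import Data.Product using (∃-syntax; _×_; _,_; proj₁)
  open import Data.Sum using (inj₁; inj₂)
  open import Data.Unit using (tt)
  open import Data.Empty using (⊥-elim)
  open import Relation.Binary.PropositionalEquality

  ∈-⋃⁻ : ∀ {k} (ss : List (Subset k)) {x} → x ∈ ⋃ ss → ∃[ s ] (s ∈ˡ ss × x ∈ s)
  ∈-⋃⁻ []       x∈ = ⊥-elim (∉⊥ x∈)
  ∈-⋃⁻ (s ∷ ss) x∈ with x∈p∪q⁻ s (⋃ ss) x∈
  ... | inj₁ x∈s  = s , here refl , x∈s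
  ... | inj₂ x∈ss with ∈-⋃⁻ ss x∈ss
  ...   | t , t∈ , x∈t = t , there t∈ , x∈t

  ∈-⋃⁺ : ∀ {k} (ss : List (Subset k)) {s x} → s ∈ˡ ss → x ∈ s → x ∈ ⋃ ss
  ∈-⋃⁺ (s ∷ ss) (here refl) x∈s = x∈p∪q⁺ (inj₁ x∈s)
  ∈-⋃⁺ (s ∷ ss) (there s∈)  x∈s = x∈p∪q⁺ (inj₂ (∈-⋃⁺ ss s∈ x∈s))

  module _ {n : ℕ} (G : Graph n) where

    edgeTerm : ∀ {k} → EdgeColoring G k → Fin n → Fin n → Subset k
    edgeTerm c v u = if adj G v u then col c v u else ⊥

    ∈-induced⁻ : ∀ {k} (c : EdgeColoring G k) v {x} → x ∈ induced G c v → ∃[ u ] (Adj G v u × x ∈ col c v u)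
    ∈-induced⁻ c v x∈ with ∈-⋃⁻ (map (edgeTerm c v) (allFin n)) x∈
    ... | s , s∈ , x∈s with ∈-map⁻ (edgeTerm c v) s∈
    ...   | u , _ , refl with adj G v u in vu
    ...     | true  = u , subst T (sym vu) tt , x∈s
    ...     | false = ⊥-elim (∉⊥ x∈s)

    ∈-induced⁺ : ∀ {k} (c : EdgeColoring G k) v u {x} → Adj G v u → x ∈ col c v u → x ∈ induced G c v
    ∈-induced⁺ c v u {x} v~u x∈ =
      ∈-⋃⁺ (map (edgeTerm c v) (allFin n)) (∈-map⁺ (edgeTerm c v) (∈-allFin u)) (edge-term (adj G v u) v~u)
      where
      edge-term : (b : Bool) → T b → x ∈ (if b then col c v u else ⊥)
      edge-term true _ = x∈

    -- A vertex labelling f by subsets of [k] comes from a strong royal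
    -- k-edge colouring, namely c(uv) = f(u) ∩ f(v), as soon as it is injective,
    -- adjacent labels overlap, and every colour of a label occurs in the label
    -- of some neighbour.
    labelling⇒strong-royal : ∀ {k} (f : Fin n → Subset k) →
      (∀ {u v} → f u ≡ f v → u ≡ v) →
      (∀ {u v} → Adj G u v → Nonempty (f u ∩ f v)) →
      (∀ v {x} → x ∈ f v → ∃[ u ] (Adj G v u × x ∈ f u)) →
      HasStrongRoyal G k
    labelling⇒strong-royal {k} f f-inj meet covered = c , λ u v eq → f-inj (trans (sym (induced≡f u)) (trans eq (induced≡f v)))
      where
      c : EdgeColoring G k
      c = record { col = λ u v → f u ∩ f v ; col-sym = λ u v → ∩-comm (f u) (f v) ; col-ne = λ u v → meet }

      induced≡f : ∀ v → induced G c v ≡ f v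
      induced≡f v = ⊆-antisym induced⊆f f⊆induced
        where
        induced⊆f : induced G c v ⊆ f v
        induced⊆f x∈ with ∈-induced⁻ c v x∈
        ... | u , _ , x∈fv∩fu = proj₁ (x∈p∩q⁻ (f v) (f u) x∈fv∩fu)
        f⊆induced : f v ⊆ induced G c v
        f⊆induced x∈fv with covered v x∈fv
        ... | u , v~u , x∈fu = ∈-induced⁺ c v u v~u (x∈p∩q⁺ (x∈fv , x∈fu))

    -- In a graph without isolated vertices, the n induced colours of a strong
    -- royal k-edge colouring are distinct and nonempty, so n < 2^k.
    strong-royal-bound : ∀ {k} → (∀ v → ∃[ u ] Adj G v u) → HasStrongRoyal G k → suc n ≤ 2 ^ k
    strong-royal-bound {k} neighbour (c , royal) = subsets-bound {f = g} g-inj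
      where
      induced-nonempty : ∀ v → Nonempty (induced G c v)
      induced-nonempty v with neighbour v
      ... | u , v~u with col-ne c v u v~u
      ...   | x , x∈ = x , ∈-induced⁺ c v u v~u x∈

      ⊥≢induced : ∀ v → ⊥ ≢ induced G c v
      ⊥≢induced v eq with induced-nonempty v
      ... | x , x∈ = ∉⊥ (subst (x ∈_) (sym eq) x∈)

      g : Fin (suc n) → Subset k
      g zero    = ⊥
      g (suc v) = induced G c v

      g-inj : ∀ {a b} → g a ≡ g b → a ≡ b
      g-inj {zero}  {zero}  _  = refl
      g-inj {zero}  {suc b} eq = ⊥-elim (⊥≢induced b eq)
      g-inj {suc a} {zero}  eq = ⊥-elim (⊥≢induced a (sym eq))
      g-inj {suc a} {suc b} eq = cong suc (royal a b eq)

module LeafSlots where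

  open import Data.Nat using (ℕ; zero; suc; _+_; _∸_; _≤_; _<_; z≤n; s≤s)
  open import Data.Nat.Properties using (_<?_; ≤-antisym; ≮⇒≥; <-irrefl; ∸-monoʳ-≤; +-mono-≤; ≤-refl)
  open import Data.List using (List; _∷_; map; upTo; length)
  open import Data.List.Properties using (length-map; length-upTo)
  open import Data.List.Membership.Propositional using (_∈_)
  open import Data.List.Membership.Propositional.Properties using (∈-map⁻; ∈-upTo⁻)
  open import Data.List.Relation.Unary.Any using (here; there)
  open import Data.List.Relation.Unary.All as All using (_∷_)
  open import Data.List.Relation.Unary.AllPairs using (_∷_)
  open import Data.List.Relation.Unary.Unique.Propositional using (Unique)
  open import Data.List.Relation.Unary.Unique.Propositional.Properties using (map⁺; upTo⁺)
  open import Data.Product using (_×_; _,_; uncurry)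
  open import Data.Unit using (⊤; tt)
  open import Data.Empty using (⊥-elim)
  open import Relation.Nullary using (¬_; Dec; yes; no)
  open import Relation.Binary.PropositionalEquality

  -- In a cubic caterpillar whose spine s₀ s₁ … s_{m-1} has m vertices, the
  -- spine vertex sᵢ has 'before i + after m i' spine neighbours (sᵢ₋₁ and
  -- sᵢ₊₁ when they exist), hence 'leafCount m i' leaf neighbours.
  before : ℕ → ℕ
  before zero    = 0
  before (suc _) = 1

  after : ℕ → ℕ → ℕ
  after m i with suc i <? m
  ... | yes _ = 1
  ... | no  _ = 0

  leafCount : ℕ → ℕ → ℕ
  leafCount m i = 3 ∸ (before i + after m i)

  after-inner : ∀ {m i} → suc i < m → after m i ≡ 1
  after-inner {m} {i} i+1<m with suc i <? m
  ... | yes _   = refl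
  ... | no  i+1≮m = ⊥-elim (i+1≮m i+1<m)

  after-end : ∀ {m i} → ¬ suc i < m → after m i ≡ 0
  after-end {m} {i} i+1≮m with suc i <? m
  ... | yes i+1<m = ⊥-elim (i+1≮m i+1<m)
  ... | no  _     = refl

  after-last : ∀ i → after (suc i) i ≡ 0
  after-last i = after-end (<-irrefl refl)

  leafCount-positive : ∀ m i → 0 < leafCount m i
  leafCount-positive m i = ∸-monoʳ-≤ 3 (+-mono-≤ (before≤1 i) (after≤1 m i))
    where
    before≤1 : ∀ i → before i ≤ 1
    before≤1 zero    = z≤n
    before≤1 (suc _) = ≤-refl
    after≤1 : ∀ m i → after m i ≤ 1
    after≤1 m i with suc i <? m
    ... | yes _ = ≤-refl
    ... | no  _ = z≤n

  leafCount-first : ∀ m → 1 < leafCount m 0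
  leafCount-first m with 1 <? m
  ... | yes _ = ≤-refl
  ... | no  _ = s≤s (s≤s z≤n)

  -- The leaves are named by leaf codes: one pendant leaf at every spine
  -- position, plus one more leaf at the first and one at the last spine vertex.
  data LeafCode : Set where
    pendant     : ℕ → LeafCode
    first final : LeafCode

  ValidLeafCode : ℕ → LeafCode → Set
  ValidLeafCode m (pendant i) = i < m
  ValidLeafCode m first       = ⊤
  ValidLeafCode m final       = ⊤

  -- A slot (i , r) is the r-th leaf of the spine vertex sᵢ.
  IsSlot : ℕ → ℕ × ℕ → Set
  IsSlot m (i , r) = i < m × r < leafCount m i

  leafCode : ℕ → ℕ → LeafCode
  leafCode i       zero          = pendant i
  leafCode zero    (suc zero)    = first
  leafCode zero    (suc (suc _)) = final
  leafCode (suc _) (suc _)       = final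

  slot : ℕ → LeafCode → ℕ × ℕ
  slot m (pendant i) = i , 0
  slot m first       = 0 , 1
  slot m final       = m ∸ 1 , leafCount m (m ∸ 1) ∸ 1

  slot-final : ∀ i → slot (suc (suc i)) final ≡ (suc i , 1)
  slot-final i rewrite after-last (suc i) = refl

  -- Leaf codes and slots are inverse to each other: this is where the shape
  -- of a cubic caterpillar (leaf counts 3 for m = 1, and 2,1,…,1,2 for m ≥ 2)
  -- enters.
  slot-leafCode : ∀ {m} i r → IsSlot m (i , r) → slot m (leafCode i r) ≡ (i , r)
  slot-leafCode i zero _ = refl
  slot-leafCode zero (suc zero) _ = refl
  slot-leafCode {suc zero} zero (suc (suc zero)) _ = refl
  slot-leafCode {suc zero} zero (suc (suc (suc r))) (_ , s≤s (s≤s (s≤s ())))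
  slot-leafCode {suc (suc m)} zero (suc (suc r)) (_ , s≤s (s≤s ()))
  slot-leafCode {m} (suc i) (suc r) (i< , r<) = at-end (suc (suc i) <? m)
    where
    at-end : Dec (suc (suc i) < m) → slot m final ≡ (suc i , suc r)
    at-end (yes inner) with subst (λ a → suc r < 3 ∸ (1 + a)) (after-inner inner) r<
    ... | s≤s ()
    at-end (no last) = last-slot (sym (≤-antisym i< (≮⇒≥ last))) r<
      where
      last-slot : ∀ {m} → m ≡ suc (suc i) → suc r < leafCount m (suc i) → slot m final ≡ (suc i , suc r)
      last-slot refl r< with subst (λ a → suc r < 3 ∸ (1 + a)) (after-last (suc i)) r<
      ... | s≤s (s≤s z≤n) = slot-final i

  leafCode-slot : ∀ {m} → 0 < m → ∀ ℓ → uncurry leafCode (slot m ℓ) ≡ ℓ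
  leafCode-slot _ (pendant i) = refl
  leafCode-slot _ first = refl
  leafCode-slot {suc zero} _ final = refl
  leafCode-slot {suc (suc m)} _ final = cong (uncurry leafCode) (slot-final m)

  slot-valid : ∀ {m} → 0 < m → ∀ ℓ → ValidLeafCode m ℓ → IsSlot m (slot m ℓ)
  slot-valid {m} _ (pendant i) i<m = i<m , leafCount-positive m i
  slot-valid {m} 0<m first _ = 0<m , leafCount-first m
  slot-valid {suc m} _ final _ = s≤s ≤-refl , pred< (leafCount-positive (suc m) m)
    where
    pred< : ∀ {a} → 0 < a → a ∸ 1 < a
    pred< {suc a} _ = s≤s ≤-refl

  leafCode-valid : ∀ {m} i r → i < m → ValidLeafCode m (leafCode i r)
  leafCode-valid i       zero          i<m = i<m
  leafCode-valid zero    (suc zero)    _   = tt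
  leafCode-valid zero    (suc (suc _)) _   = tt
  leafCode-valid (suc _) (suc _)       _   = tt

  leafCodes : ℕ → List LeafCode
  leafCodes m = first ∷ final ∷ map pendant (upTo m)

  leafCodes-length : ∀ m → length (leafCodes m) ≡ 2 + m
  leafCodes-length m = cong (λ k → 2 + k) (trans (length-map pendant (upTo m)) (length-upTo m))

  leafCodes-valid : ∀ m {ℓ} → ℓ ∈ leafCodes m → ValidLeafCode m ℓ
  leafCodes-valid m (here refl) = tt
  leafCodes-valid m (there (here refl)) = tt
  leafCodes-valid m (there (there ℓ∈)) with ∈-map⁻ pendant ℓ∈
  ... | i , i∈ , refl = ∈-upTo⁻ i∈

  leafCodes-unique : ∀ m → Unique (leafCodes m)
  leafCodes-unique m = ((λ ()) ∷ All.tabulate first∉) ∷ All.tabulate final∉ ∷ map⁺ pendant-injective (upTo⁺ m)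
    where
    pendant-injective : ∀ {i j} → pendant i ≡ pendant j → i ≡ j
    pendant-injective refl = refl
    first∉ : ∀ {ℓ} → ℓ ∈ map pendant (upTo m) → first ≢ ℓ
    first∉ ℓ∈ with ∈-map⁻ pendant ℓ∈
    ... | _ , _ , refl = λ ()
    final∉ : ∀ {ℓ} → ℓ ∈ map pendant (upTo m) → final ≢ ℓ
    final∉ ℓ∈ with ∈-map⁻ pendant ℓ∈
    ... | _ , _ , refl = λ ()

module VertexLabels where

  open SubsetCodes
  open LeafSlots
  open import Data.Nat using (ℕ; zero; suc; _+_; _∸_; _^_; _<_; z≤n; s≤s)
  open import Data.Nat.Properties using (+-suc; +-monoʳ-<; m≤m+n; suc-injective; <-irrefl; +-cancelˡ-≡)
  open import Data.Bool using (true; false)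
  open import Data.Fin using (zero; suc)
  open import Data.Fin.Subset using (Subset; _∈_; _⊆_; ⊥; ⊤; Nonempty)
  open import Data.Fin.Subset.Properties using (∉⊥; ⊆⊤)
  open import Data.Vec using (_∷_)
  open import Data.Vec.Base using (here; there)
  open import Data.Vec.Properties using (∷-injectiveʳ)
  open import Data.Product using (_,_; proj₁)
  open import Data.Sum using (_⊎_; inj₁; inj₂)
  open import Data.Empty using (⊥-elim)
  open import Relation.Binary.PropositionalEquality

  -- Vertices of a cubic caterpillar are named by codes: spine positions and
  -- leaf codes.
  data Code : Set where
    spine : ℕ → Code
    leaf  : LeafCode → Code

  ValidCode : ℕ → Code → Set
  ValidCode m (spine i) = i < m
  ValidCode m (leaf ℓ)  = ValidLeafCode m ℓ

  parentPosition : ℕ → LeafCode → ℕ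
  parentPosition m ℓ = proj₁ (slot m ℓ)

  ∷-⊆ : ∀ {j b} {s t : Subset j} → s ⊆ t → (b ∷ s) ⊆ (true ∷ t)
  ∷-⊆ s⊆t here        = here
  ∷-⊆ s⊆t (there x∈s) = there (s⊆t x∈s)

  -- Colour 0 marks the spine vertices and
  -- the first extra leaf; on the remaining colours [j], the i-th spine vertex
  -- and its pendant leaf carry the binary encoding of c+i+1, so the last spine
  -- vertex carries the full set, and the final extra leaf carries that of c.
  module Labelling (j m c : ℕ) (0<c : 0 < c) (0<m : 0 < m) (size : suc (c + m) ≡ 2 ^ j) where

    S : ℕ → Subset j
    S i = encode j (suc (c + i))

    X : Subset j
    X = encode j c

    label : Code → Subset (suc j)
    label (spine i)          = true  ∷ S i
    label (leaf (pendant i)) = false ∷ S i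
    label (leaf first)       = true  ∷ ⊥
    label (leaf final)       = false ∷ X

    S-bound : ∀ {i} → i < m → suc (c + i) < 2 ^ j
    S-bound i<m = subst (_ <_) size (s≤s (+-monoʳ-< c i<m))

    X-bound : c < 2 ^ j
    X-bound = subst (c <_) size (s≤s (m≤m+n c m))

    S-injective : ∀ {i i'} → i < m → i' < m → S i ≡ S i' → i ≡ i'
    S-injective i< i'< eq = +-cancelˡ-≡ c _ _ (suc-injective (encode-injective j (S-bound i<) (S-bound i'<) eq))

    S≢X : ∀ {i} → i < m → S i ≢ X
    S≢X {i} i< eq = <-irrefl (sym (encode-injective j (S-bound i<) X-bound eq)) (s≤s (m≤m+n c i))

    S-nonempty : ∀ {i} → i < m → Nonempty (S i)
    S-nonempty i< = encode-nonempty j (s≤s z≤n) (S-bound i<)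

    S-last : S (m ∸ 1) ≡ ⊤
    S-last = trans (cong (encode j) (last-code m 0<m)) (encode-⊤ j size)
      where
      last-code : ∀ m → 0 < m → suc (c + (m ∸ 1)) ≡ c + m
      last-code (suc m) _ = sym (+-suc c m)

    label-injective : ∀ {a b} → ValidCode m a → ValidCode m b → label a ≡ label b → a ≡ b
    label-injective {spine i} {spine i'} i< i'< eq = cong spine (S-injective i< i'< (∷-injectiveʳ eq))
    label-injective {spine i} {leaf first} i< _ eq = ⊥-elim (nonempty≢⊥ (S-nonempty i<) (∷-injectiveʳ eq))
      where
      nonempty≢⊥ : ∀ {s : Subset j} → Nonempty s → s ≢ ⊥
      nonempty≢⊥ (x , x∈) refl = ∉⊥ x∈
    label-injective {leaf first} {spine i} _ i< eq = sym (label-injective {spine i} {leaf first} i< _ (sym eq))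
    label-injective {leaf (pendant i)} {leaf (pendant i')} i< i'< eq =
      cong (λ i → leaf (pendant i)) (S-injective i< i'< (∷-injectiveʳ eq))
    label-injective {leaf (pendant i)} {leaf final} i< _ eq = ⊥-elim (S≢X i< (∷-injectiveʳ eq))
    label-injective {leaf final} {leaf (pendant i)} _ i< eq = ⊥-elim (S≢X i< (sym (∷-injectiveʳ eq)))
    label-injective {leaf first} {leaf first} _ _ _ = refl
    label-injective {leaf final} {leaf final} _ _ _ = refl
    label-injective {spine _} {leaf (pendant _)} _ _ ()
    label-injective {spine _} {leaf final} _ _ ()
    label-injective {leaf (pendant _)} {spine _} _ _ ()
    label-injective {leaf (pendant _)} {leaf first} _ _ ()
    label-injective {leaf first} {leaf (pendant _)} _ _ ()
    label-injective {leaf first} {leaf final} _ _ ()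
    label-injective {leaf final} {spine _} _ _ ()
    label-injective {leaf final} {leaf first} _ _ ()

    leaf-nonempty : ∀ ℓ → ValidLeafCode m ℓ → Nonempty (label (leaf ℓ))
    leaf-nonempty (pendant i) i< with S-nonempty i<
    ... | x , x∈ = suc x , there x∈
    leaf-nonempty first _ = zero , here
    leaf-nonempty final _ with encode-nonempty j 0<c X-bound
    ... | x , x∈ = suc x , there x∈

    leaf⊆parent : ∀ ℓ → label (leaf ℓ) ⊆ label (spine (parentPosition m ℓ))
    leaf⊆parent (pendant i) = ∷-⊆ (λ x∈ → x∈)
    leaf⊆parent first       = ∷-⊆ (λ x∈ → ⊥-elim (∉⊥ x∈))
    leaf⊆parent final       = subst (λ t → label (leaf final) ⊆ (true ∷ t)) (sym S-last) (∷-⊆ ⊆⊤)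

    spine-colours : ∀ i {x} → x ∈ label (spine i) → x ≡ zero ⊎ x ∈ label (leaf (pendant i))
    spine-colours i here       = inj₁ refl
    spine-colours i (there x∈) = inj₂ (there x∈)

module Caterpillars where

  open import Defs hiding (sym)
  open ListFacts
  open LeafSlots
  open VertexLabels
  open RoyalColourings
  open import Data.Nat using (ℕ; zero; suc; _+_; _∸_; _^_; _≤_; _<_; z≤n; s≤s; _≟_)
  open import Data.Nat.Properties using (_<?_; ≤-trans; <-trans; n<1+n; n≤1+n; <⇒≢; m+n∸m≡n; +-suc; m∸n+n≡m; m<n⇒0<n∸m)
  open import Data.Bool using (T)
  open import Data.Bool.Properties using (T?)
  open import Data.Fin using (Fin; zero; suc; fromℕ<)
  open import Data.Fin.Properties using () renaming (_≟_ to _≟ᶠ_)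
  open import Data.Fin.Subset using (Subset; Nonempty; _⊆_; _∩_) renaming (_∈_ to _∈ˢ_)
  open import Data.Fin.Subset.Properties using (x∈p∩q⁺; ∩-comm)
  import Data.Vec.Base as Vec
  open import Data.List using (List; []; _∷_; _++_; length; map; filter; allFin; take; drop)
  open import Data.List.Properties using (length-++; length-map)
  open import Data.List.Membership.Propositional using (_∈_; _∉_)
  open import Data.List.Membership.Propositional.Properties using (∈-filter⁺; ∈-filter⁻; ∈-allFin; ∈-++⁺ˡ; ∈-++⁺ʳ; ∈-++⁻; ∈-map⁻)
  open import Data.List.Relation.Unary.Any using (here; there)
  open import Data.List.Relation.Unary.All using ([]; _∷_)
  open import Data.List.Relation.Unary.AllPairs using ([]; _∷_)
  open import Data.List.Relation.Unary.Unique.Propositional using (Unique)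
  open import Data.List.Relation.Unary.Unique.Propositional.Properties using (filter⁺; allFin⁺; ++⁺)
  open import Data.Product using (∃-syntax; _×_; _,_; proj₁; proj₂; uncurry)
  open import Data.Sum using (_⊎_; inj₁; inj₂)
  open import Data.Unit using (tt)
  open import Data.Empty using (⊥; ⊥-elim)
  open import Function using (_⇔_; mk⇔; Equivalence; _∘_)
  open import Relation.Nullary using (¬_; Dec; yes; no; ¬?)
  open import Relation.Binary.PropositionalEquality

  open Equivalence using (to; from)

  third-element : ∀ {n} → 3 ≤ n → (a b : Fin n) → ∃[ w ] (w ≢ a × w ≢ b)
  third-element {suc zero} (s≤s ()) _ _
  third-element {suc (suc zero)} (s≤s (s≤s ())) _ _
  third-element {suc (suc (suc _))} _ a b with zero ≟ᶠ a | zero ≟ᶠ b | suc zero ≟ᶠ a | suc zero ≟ᶠ b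
  ... | no 0≢a   | no 0≢b   | _        | _        = zero , 0≢a , 0≢b
  ... | _        | _        | no 1≢a   | no 1≢b   = suc zero , 1≢a , 1≢b
  ... | yes refl | _        | _        | yes refl = suc (suc zero) , (λ ()) , (λ ())
  ... | _        | yes refl | yes refl | _        = suc (suc zero) , (λ ()) , (λ ())
  ... | yes refl | _        | yes ()   | _
  ... | _        | yes refl | _        | yes ()

  module _ {n : ℕ} (G : Graph n) where

    adjacent-sym : ∀ {u v} → Adj G u v → Adj G v u
    adjacent-sym {u} {v} = subst T (Graph.sym G u v)

    neighbours : Fin n → List (Fin n)
    neighbours v = filter (λ u → T? (adj G v u)) (allFin n)

    ∈-neighbours : ∀ {u v} → u ∈ neighbours v ⇔ Adj G v u
    ∈-neighbours {v = v} = mk⇔ (proj₂ ∘ ∈-filter⁻ (λ u → T? (adj G v u)) {xs = allFin n})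
                               (∈-filter⁺ (λ u → T? (adj G v u)) (∈-allFin _))

    neighbours-unique : ∀ v → Unique (neighbours v)
    neighbours-unique v = filter⁺ (λ u → T? (adj G v u)) (allFin⁺ n)

    degree≡length : ∀ v → degree G v ≡ length (neighbours v)
    degree≡length v = sum-indicator (adj G v) (allFin n)

  module CubicCaterpillar {n : ℕ} (G : Graph n) (n≥4 : 4 ≤ n) (connected : Connected G)
    (cubic : ∀ v → ¬ IsLeaf G v → degree G v ≡ 3)
    (p : List (Fin n)) (p-unique : Unique p)
    (spine⇔ : ∀ v → (v ∈ p) ⇔ (¬ IsLeaf G v))
    (adjacent⇔ : ∀ u v → u ∈ p → v ∈ p → Adj G u v ⇔ Consecutive G p u v) where

    open import Data.List.Membership.DecPropositional (_≟ᶠ_ {n}) using (_∈?_)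

    m : ℕ
    m = length p

    n≥3 : 3 ≤ n
    n≥3 = ≤-trans (n≤1+n 3) n≥4

    zero′ : Fin n
    zero′ = fromℕ< (≤-trans (s≤s z≤n) n≥4)

    open Positions (_≟ᶠ_ {n}) zero′

    s : ℕ → Fin n
    s = at p

    pos : Fin n → ℕ
    pos v = position v p

    s-pos : ∀ {v} → v ∈ p → s (pos v) ≡ v
    s-pos = at-position p

    pos-s : ∀ {i} → i < m → pos (s i) ≡ i
    pos-s = position-at p p-unique

    leaf-degree : ∀ {v} → v ∉ p → length (neighbours G v) ≡ 1
    leaf-degree {v} v∉p with degree G v ≟ 1
    ... | yes deg≡1   = trans (sym (degree≡length G v)) deg≡1
    ... | no  nonleaf = ⊥-elim (v∉p (from (spine⇔ v) nonleaf))

    spine-degree : ∀ {v} → v ∈ p → length (neighbours G v) ≡ 3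
    spine-degree {v} v∈p = trans (sym (degree≡length G v)) (cubic v (to (spine⇔ v) v∈p))

    leaf-neighbour-unique : ∀ {l u w} → l ∉ p → Adj G l u → Adj G l w → u ≡ w
    leaf-neighbour-unique l∉p l~u l~w =
      length≡1⇒same-member (leaf-degree l∉p) (from (∈-neighbours G) l~u) (from (∈-neighbours G) l~w)

    some-neighbour : ∀ v → ∃[ u ] Adj G v u
    some-neighbour v with third-element n≥3 v v
    ... | w , w≢v , _ with connected v w
    ...   | here          = ⊥-elim (w≢v refl)
    ...   | step v~u _    = _ , v~u

    parent : Fin n → Fin n
    parent v = proj₁ (some-neighbour v)

    parent-adjacent : ∀ v → Adj G v (parent v)
    parent-adjacent v = proj₂ (some-neighbour v)

    parent-unique : ∀ {l u} → l ∉ p → Adj G l u → parent l ≡ u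
    parent-unique l∉p = leaf-neighbour-unique l∉p (parent-adjacent _)

    -- An edge between two leaves would be a whole component, as no walk can
    -- leave it; since there are at least three vertices, the neighbour of a
    -- leaf lies on the spine.
    leaf-edge-closed : ∀ {l u} → l ∉ p → u ∉ p → Adj G l u →
      ∀ {x y} → Walk G x y → x ≡ l ⊎ x ≡ u → y ≡ l ⊎ y ≡ u
    leaf-edge-closed _   _   _   here              x∈ = x∈
    leaf-edge-closed l∉p u∉p l~u (step l~w walk) (inj₁ refl) =
      leaf-edge-closed l∉p u∉p l~u walk (inj₂ (leaf-neighbour-unique l∉p l~w l~u))
    leaf-edge-closed l∉p u∉p l~u (step u~w walk) (inj₂ refl) =
      leaf-edge-closed l∉p u∉p l~u walk (inj₁ (leaf-neighbour-unique u∉p u~w (adjacent-sym G l~u)))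

    leaf-neighbour-spine : ∀ {l u} → l ∉ p → Adj G l u → u ∈ p
    leaf-neighbour-spine {l} {u} l∉p l~u with u ∈? p
    ... | yes u∈p = u∈p
    ... | no  u∉p with third-element n≥3 l u
    ...   | w , w≢l , w≢u with leaf-edge-closed l∉p u∉p l~u (connected l w) (inj₁ refl)
    ...     | inj₁ w≡l = ⊥-elim (w≢l w≡l)
    ...     | inj₂ w≡u = ⊥-elim (w≢u w≡u)

    parent-spine : ∀ {l} → l ∉ p → parent l ∈ p
    parent-spine l∉p = leaf-neighbour-spine l∉p (parent-adjacent _)

    below : ∀ {i} → suc i < m → i < m
    below = <-trans (n<1+n _)

    spine-step : ∀ {i} → suc i < m → Adj G (s i) (s (suc i))
    spine-step {i} i+1<m = from (adjacent⇔ _ _ (at∈ p (below i+1<m)) (at∈ p i+1<m))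
      (take i p , drop (suc (suc i)) p , inj₁ (split-at p i+1<m))

    consecutive-in : ∀ {a b xs ys} → p ≡ xs ++ a ∷ b ∷ ys → pos b ≡ suc (pos a)
    consecutive-in {a} {b} {xs} p≡ =
      subst (λ q → position b q ≡ suc (position a q)) (sym p≡) (consecutive-positions xs (subst Unique p≡ p-unique))

    spine-adjacent-positions : ∀ {u v} → u ∈ p → v ∈ p → Adj G u v → pos v ≡ suc (pos u) ⊎ pos u ≡ suc (pos v)
    spine-adjacent-positions {u} {v} u∈p v∈p u~v with to (adjacent⇔ u v u∈p v∈p) u~v
    ... | xs , ys , inj₁ p≡ = inj₁ (consecutive-in p≡)
    ... | xs , ys , inj₂ p≡ = inj₂ (consecutive-in p≡)

    earlier : ℕ → List (Fin n)
    earlier zero    = []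
    earlier (suc i) = s i ∷ []

    later : ℕ → List (Fin n)
    later i with suc i <? m
    ... | yes _ = s (suc i) ∷ []
    ... | no  _ = []

    spineNeighbours : ℕ → List (Fin n)
    spineNeighbours i = earlier i ++ later i

    spineNeighbours-length : ∀ i → length (spineNeighbours i) ≡ before i + after m i
    spineNeighbours-length i = trans (length-++ (earlier i)) (cong₂ _+_ (earlier-length i) later-length)
      where
      earlier-length : ∀ i → length (earlier i) ≡ before i
      earlier-length zero    = refl
      earlier-length (suc _) = refl
      later-length : length (later i) ≡ after m i
      later-length with suc i <? m
      ... | yes _ = refl
      ... | no  _ = refl

    earlier⁻ : ∀ {i u} → u ∈ earlier i → ∃[ k ] (i ≡ suc k × u ≡ s k)
    earlier⁻ {suc k} (here refl) = k , refl , refl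

    ∈-later : ∀ {i} → suc i < m → s (suc i) ∈ later i
    ∈-later {i} i+1<m with suc i <? m
    ... | yes _     = here refl
    ... | no  i+1≮m = ⊥-elim (i+1≮m i+1<m)

    later⁻ : ∀ {i u} → u ∈ later i → u ≡ s (suc i) × suc i < m
    later⁻ {i} u∈ with suc i <? m
    later⁻ (here refl) | yes i+1<m = refl , i+1<m

    earlier-later-disjoint : ∀ i {u} → u ∈ earlier i → u ∈ later i → ⊥
    earlier-later-disjoint i u∈ u∈later with earlier⁻ u∈ | later⁻ u∈later
    ... | k , refl , refl | s≡ , k+2<m = <⇒≢ (<-trans (n<1+n k) (n<1+n (suc k)))
      (trans (sym (pos-s (below (below k+2<m)))) (trans (cong pos s≡) (pos-s k+2<m)))

    spineNeighbours-unique : ∀ i → Unique (spineNeighbours i)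
    spineNeighbours-unique i =
      ++⁺ (earlier-unique i) (later-unique i) (λ (u∈ , u∈′) → earlier-later-disjoint i u∈ u∈′)
      where
      earlier-unique : ∀ i → Unique (earlier i)
      earlier-unique zero    = []
      earlier-unique (suc _) = [] ∷ []
      later-unique : ∀ i → Unique (later i)
      later-unique i with suc i <? m
      ... | yes _ = [] ∷ []
      ... | no  _ = []

    ∈-spineNeighbours : ∀ {i u} → i < m → u ∈ spineNeighbours i ⇔ (Adj G (s i) u × u ∈ p)
    ∈-spineNeighbours {i} {u} i<m = mk⇔ members (λ (sᵢ~u , u∈p) → neighbour sᵢ~u u∈p)
      where
      members : u ∈ spineNeighbours i → Adj G (s i) u × u ∈ p
      members u∈ with ∈-++⁻ (earlier i) u∈
      members u∈ | inj₁ u∈earlier with earlier⁻ u∈earlier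
      ... | k , refl , refl = adjacent-sym G (spine-step i<m) , at∈ p (below i<m)
      members u∈ | inj₂ u∈later with later⁻ u∈later
      ... | refl , i+1<m = spine-step i+1<m , at∈ p i+1<m

      neighbour : Adj G (s i) u → u ∈ p → u ∈ spineNeighbours i
      neighbour sᵢ~u u∈p with spine-adjacent-positions (at∈ p i<m) u∈p sᵢ~u
      ... | inj₁ next = ∈-++⁺ʳ (earlier i) (subst (_∈ later i) u≡ (∈-later i+1<m))
        where
        pos-u : pos u ≡ suc i
        pos-u = trans next (cong suc (pos-s i<m))
        i+1<m : suc i < m
        i+1<m = subst (_< m) pos-u (position< p u∈p)
        u≡ : s (suc i) ≡ u
        u≡ = trans (cong s (sym pos-u)) (s-pos u∈p)
      ... | inj₂ previous = ∈-++⁺ˡ (subst (λ k → u ∈ earlier k) i≡ (here (sym (s-pos u∈p))))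
        where
        i≡ : suc (pos u) ≡ i
        i≡ = trans (sym previous) (pos-s i<m)

    leavesOf : Fin n → List (Fin n)
    leavesOf v = filter (λ u → ¬? (u ∈? p)) (neighbours G v)

    ∈-leavesOf : ∀ {u v} → u ∈ leavesOf v ⇔ (Adj G v u × u ∉ p)
    ∈-leavesOf {u} {v} = mk⇔
      (λ u∈ → let (u∈nbrs , u∉p) = ∈-filter⁻ (λ u → ¬? (u ∈? p)) {xs = neighbours G v} u∈
              in to (∈-neighbours G) u∈nbrs , u∉p)
      (λ (v~u , u∉p) → ∈-filter⁺ (λ u → ¬? (u ∈? p)) (from (∈-neighbours G) v~u) u∉p)

    leavesOf-unique : ∀ v → Unique (leavesOf v)
    leavesOf-unique v = filter⁺ (λ u → ¬? (u ∈? p)) (neighbours-unique G v)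

    -- The three neighbours of sᵢ split into its spine neighbours and its
    -- leaves, so sᵢ has leafCount m i leaves.
    leavesOf-length : ∀ {i} → i < m → length (leavesOf (s i)) ≡ leafCount m i
    leavesOf-length {i} i<m = begin
      length (leavesOf (s i))                                  ≡⟨ m+n∸m≡n (length (spineNeighbours i)) _ ⟨
      length (spineNeighbours i) + length (leavesOf (s i)) ∸ length (spineNeighbours i)
                                                               ≡⟨ cong₂ _∸_ three (spineNeighbours-length i) ⟩
      leafCount m i                                            ∎
      where
      open ≡-Reasoning
      split : ∀ {u} → u ∈ spineNeighbours i ++ leavesOf (s i) ⇔ u ∈ neighbours G (s i)
      split {u} = mk⇔ (λ u∈ → from (∈-neighbours G) (outof (∈-++⁻ (spineNeighbours i) u∈))) into
        where
        into : u ∈ neighbours G (s i) → u ∈ spineNeighbours i ++ leavesOf (s i)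
        into u∈ with u ∈? p
        ... | yes u∈p = ∈-++⁺ˡ (from (∈-spineNeighbours i<m) (to (∈-neighbours G) u∈ , u∈p))
        ... | no  u∉p = ∈-++⁺ʳ (spineNeighbours i) (from ∈-leavesOf (to (∈-neighbours G) u∈ , u∉p))
        outof : u ∈ spineNeighbours i ⊎ u ∈ leavesOf (s i) → Adj G (s i) u
        outof (inj₁ u∈) = proj₁ (to (∈-spineNeighbours i<m) u∈)
        outof (inj₂ u∈) = proj₁ (to ∈-leavesOf u∈)
      three : length (spineNeighbours i) + length (leavesOf (s i)) ≡ 3
      three = begin
        length (spineNeighbours i) + length (leavesOf (s i)) ≡⟨ length-++ (spineNeighbours i) ⟨
        length (spineNeighbours i ++ leavesOf (s i))         ≡⟨ sameLength disjoint-union (neighbours-unique G (s i)) split ⟩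
        length (neighbours G (s i))                          ≡⟨ spine-degree (at∈ p i<m) ⟩
        3                                                    ∎
        where
        disjoint-union : Unique (spineNeighbours i ++ leavesOf (s i))
        disjoint-union = ++⁺ (spineNeighbours-unique i) (leavesOf-unique (s i))
                             (λ (u∈ , u∈′) → proj₂ (to ∈-leavesOf u∈′) (proj₂ (to (∈-spineNeighbours i<m) u∈)))

    -- The slot of a leaf: the position of its parent and its rank among the
    -- leaves of its parent.  Slots and leaves correspond one-to-one.
    leafSlot : Fin n → ℕ × ℕ
    leafSlot l = pos (parent l) , position l (leavesOf (parent l))

    leafAt : ℕ × ℕ → Fin n
    leafAt (i , r) = at (leavesOf (s i)) r

    leaf∈leavesOf-parent : ∀ {l} → l ∉ p → l ∈ leavesOf (parent l)
    leaf∈leavesOf-parent {l} l∉p = from ∈-leavesOf (adjacent-sym G (parent-adjacent l) , l∉p)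

    leafSlot-isSlot : ∀ {l} → l ∉ p → IsSlot m (leafSlot l)
    leafSlot-isSlot {l} l∉p =
      position< p parent∈p , subst (proj₂ (leafSlot l) <_) leaf-count (position< _ (leaf∈leavesOf-parent l∉p))
      where
      parent∈p : parent l ∈ p
      parent∈p = parent-spine l∉p
      leaf-count : length (leavesOf (parent l)) ≡ leafCount m (pos (parent l))
      leaf-count = trans (cong (length ∘ leavesOf) (sym (s-pos parent∈p))) (leavesOf-length (position< p parent∈p))

    leafAt-leaf : ∀ {i r} → IsSlot m (i , r) → leafAt (i , r) ∈ leavesOf (s i)
    leafAt-leaf {i} {r} (i<m , r<) = at∈ _ (subst (r <_) (sym (leavesOf-length i<m)) r<)

    leafAt-leafSlot : ∀ {l} → l ∉ p → leafAt (leafSlot l) ≡ l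
    leafAt-leafSlot {l} l∉p =
      trans (cong (λ v → at (leavesOf v) (position l (leavesOf (parent l)))) (s-pos (parent-spine l∉p)))
            (at-position _ (leaf∈leavesOf-parent l∉p))

    leafSlot-leafAt : ∀ {i r} → IsSlot m (i , r) → leafSlot (leafAt (i , r)) ≡ (i , r)
    leafSlot-leafAt {i} {r} isSlot@(i<m , r<) =
      trans (cong (λ v → pos v , position ℓ (leavesOf v)) parent≡)
            (cong₂ _,_ (pos-s i<m) (position-at _ (leavesOf-unique (s i)) (subst (r <_) (sym (leavesOf-length i<m)) r<)))
      where
      ℓ : Fin n
      ℓ = leafAt (i , r)
      parent≡ : parent ℓ ≡ s i
      parent≡ = let (sᵢ~ℓ , ℓ∉p) = to ∈-leavesOf (leafAt-leaf isSlot) in parent-unique ℓ∉p (adjacent-sym G sᵢ~ℓ)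

    leafCodeOf : Fin n → LeafCode
    leafCodeOf l = uncurry leafCode (leafSlot l)

    code : Fin n → Code
    code v with v ∈? p
    ... | yes _ = spine (pos v)
    ... | no  _ = leaf (leafCodeOf v)

    code-spine : ∀ {v} → v ∈ p → code v ≡ spine (pos v)
    code-spine {v} v∈p with v ∈? p
    ... | yes _   = refl
    ... | no  v∉p = ⊥-elim (v∉p v∈p)

    code-leaf : ∀ {v} → v ∉ p → code v ≡ leaf (leafCodeOf v)
    code-leaf {v} v∉p with v ∈? p
    ... | yes v∈p = ⊥-elim (v∉p v∈p)
    ... | no  _   = refl

    slot-leafCodeOf : ∀ {l} → l ∉ p → slot m (leafCodeOf l) ≡ leafSlot l
    slot-leafCodeOf l∉p = slot-leafCode _ _ (leafSlot-isSlot l∉p)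

    leafCodeOf-valid : ∀ {l} → l ∉ p → ValidLeafCode m (leafCodeOf l)
    leafCodeOf-valid l∉p = leafCode-valid _ _ (proj₁ (leafSlot-isSlot l∉p))

    code-valid : ∀ v → ValidCode m (code v)
    code-valid v with v ∈? p
    ... | yes v∈p = position< p v∈p
    ... | no  v∉p = leafCodeOf-valid v∉p

    spine-code≢leaf-code : ∀ {u v} → u ∈ p → v ∉ p → code u ≢ code v
    spine-code≢leaf-code u∈p v∉p eq with trans (sym (code-spine u∈p)) (trans eq (code-leaf v∉p))
    ... | ()

    code-injective : ∀ {u v} → code u ≡ code v → u ≡ v
    code-injective {u} {v} eq = by-cases (u ∈? p) (v ∈? p)
      where
      open ≡-Reasoning
      by-cases : Dec (u ∈ p) → Dec (v ∈ p) → u ≡ v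
      by-cases (yes u∈p) (yes v∈p) =
        position-injective p u∈p v∈p (spine-injective (trans (sym (code-spine u∈p)) (trans eq (code-spine v∈p))))
        where
        spine-injective : ∀ {i j} → spine i ≡ spine j → i ≡ j
        spine-injective refl = refl
      by-cases (yes u∈p) (no v∉p) = ⊥-elim (spine-code≢leaf-code u∈p v∉p eq)
      by-cases (no u∉p) (yes v∈p) = ⊥-elim (spine-code≢leaf-code v∈p u∉p (sym eq))
      by-cases (no u∉p) (no v∉p) = begin
        u                   ≡⟨ leafAt-leafSlot u∉p ⟨
        leafAt (leafSlot u) ≡⟨ cong leafAt same-slot ⟩
        leafAt (leafSlot v) ≡⟨ leafAt-leafSlot v∉p ⟩
        v                   ∎
        where
        leaf-injective : ∀ {ℓ ℓ'} → leaf ℓ ≡ leaf ℓ' → ℓ ≡ ℓ'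
        leaf-injective refl = refl
        same-code : leafCodeOf u ≡ leafCodeOf v
        same-code = leaf-injective (trans (sym (code-leaf u∉p)) (trans eq (code-leaf v∉p)))
        same-slot : leafSlot u ≡ leafSlot v
        same-slot = trans (sym (slot-leafCodeOf u∉p)) (trans (cong (slot m) same-code) (slot-leafCodeOf v∉p))

    slot-leaf : ∀ {i r} → IsSlot m (i , r) → Adj G (s i) (leafAt (i , r)) × code (leafAt (i , r)) ≡ leaf (leafCode i r)
    slot-leaf isSlot with to ∈-leavesOf (leafAt-leaf isSlot)
    ... | sᵢ~ℓ , ℓ∉p = sᵢ~ℓ , trans (code-leaf ℓ∉p) (cong (leaf ∘ uncurry leafCode) (leafSlot-leafAt isSlot))

    -- the spine is nonempty: a vertex is on it, or its parent is
    spine-nonempty : 0 < m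
    spine-nonempty with zero′ ∈? p
    ... | yes v∈p = member⇒nonempty v∈p
    ... | no  v∉p = member⇒nonempty (parent-spine v∉p)

    -- the spine vertices and the m + 2 leaves named by leaf codes are distinct,
    -- so n ≥ 2m + 2
    order-bound : m + (2 + m) ≤ n
    order-bound = subst (_≤ n) vertices-length (unique⇒length≤ vertices-unique)
      where
      leafVertices : List (Fin n)
      leafVertices = map (leafAt ∘ slot m) (leafCodes m)

      leafVertex-leaf : ∀ {v} → v ∈ leafVertices → v ∉ p
      leafVertex-leaf v∈ with ∈-map⁻ (leafAt ∘ slot m) v∈
      ... | ℓ , ℓ∈ , refl = proj₂ (to ∈-leavesOf (leafAt-leaf (slot-valid spine-nonempty ℓ (leafCodes-valid m ℓ∈))))

      code-of-leafVertex : ∀ {ℓ} → ℓ ∈ leafCodes m → leafCodeOf (leafAt (slot m ℓ)) ≡ ℓ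
      code-of-leafVertex {ℓ} ℓ∈ =
        trans (cong (uncurry leafCode) (leafSlot-leafAt (slot-valid spine-nonempty ℓ (leafCodes-valid m ℓ∈))))
              (leafCode-slot spine-nonempty ℓ)

      vertices-unique : Unique (p ++ leafVertices)
      vertices-unique = ++⁺ p-unique (map-unique leafCodeOf code-of-leafVertex (leafCodes-unique m))
                            (λ (v∈p , v∈) → leafVertex-leaf v∈ v∈p)

      vertices-length : length (p ++ leafVertices) ≡ m + (2 + m)
      vertices-length = trans (length-++ p) (cong (m +_) (trans (length-map (leafAt ∘ slot m) (leafCodes m)) (leafCodes-length m)))

    module Colouring (j : ℕ) (fits : 2 + m ≤ 2 ^ j) where

      c : ℕ
      c = 2 ^ j ∸ suc m

      size : suc (c + m) ≡ 2 ^ j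
      size = trans (sym (+-suc c m)) (m∸n+n≡m (≤-trans (n≤1+n (suc m)) fits))

      open Labelling j m c (m<n⇒0<n∸m fits) spine-nonempty size

      f : Fin n → Subset (suc j)
      f v = label (code v)

      f-injective : ∀ {u v} → f u ≡ f v → u ≡ v
      f-injective {u} {v} eq = code-injective (label-injective (code-valid u) (code-valid v) eq)

      f-spine : ∀ {v} → v ∈ p → f v ≡ label (spine (pos v))
      f-spine v∈p = cong label (code-spine v∈p)

      zero∈f-spine : ∀ {v} → v ∈ p → zero ∈ˢ f v
      zero∈f-spine v∈p = subst (zero ∈ˢ_) (sym (f-spine v∈p)) Vec.here

      f-leaf-nonempty : ∀ {l} → l ∉ p → Nonempty (f l)
      f-leaf-nonempty l∉p = subst Nonempty (sym (cong label (code-leaf l∉p))) (leaf-nonempty _ (leafCodeOf-valid l∉p))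

      f-leaf⊆f-parent : ∀ {l} → l ∉ p → f l ⊆ f (parent l)
      f-leaf⊆f-parent {l} l∉p {x} x∈ = subst (x ∈ˢ_) (sym (f-spine (parent-spine l∉p)))
        (subst (λ i → x ∈ˢ label (spine i)) (cong proj₁ (slot-leafCodeOf l∉p))
          (leaf⊆parent (leafCodeOf l) (subst (x ∈ˢ_) (cong label (code-leaf l∉p)) x∈)))

      -- an edge at a leaf joins it to its parent, which contains its label
      leaf-edge-meet : ∀ {l u} → l ∉ p → Adj G l u → Nonempty (f l ∩ f u)
      leaf-edge-meet l∉p l~u with f-leaf-nonempty l∉p
      ... | x , x∈ = x , x∈p∩q⁺ (x∈ , subst (λ v → x ∈ˢ f v) (parent-unique l∉p l~u) (f-leaf⊆f-parent l∉p x∈))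

      f-meet : ∀ {u v} → Adj G u v → Nonempty (f u ∩ f v)
      f-meet {u} {v} u~v = by-cases (u ∈? p) (v ∈? p)
        where
        by-cases : Dec (u ∈ p) → Dec (v ∈ p) → Nonempty (f u ∩ f v)
        by-cases (yes u∈p) (yes v∈p) = zero , x∈p∩q⁺ (zero∈f-spine u∈p , zero∈f-spine v∈p)
        by-cases (no  u∉p) _         = leaf-edge-meet u∉p u~v
        by-cases (yes _)   (no  v∉p) = subst Nonempty (∩-comm (f v) (f u)) (leaf-edge-meet v∉p (adjacent-sym G u~v))

      -- colour 0 of sᵢ is on sᵢ₋₁, or on the first extra leaf when i = 0
      zero-covered : ∀ {i} → i < m → ∃[ u ] (Adj G (s i) u × zero ∈ˢ f u)
      zero-covered {zero} _ with slot-leaf (slot-valid spine-nonempty first tt)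
      ... | s₀~ℓ , code≡ = _ , s₀~ℓ , subst (zero ∈ˢ_) (sym (cong label code≡)) Vec.here
      zero-covered {suc k} k+1<m =
        s k , adjacent-sym G (spine-step k+1<m) , zero∈f-spine (at∈ p (below k+1<m))

      -- any other colour of sᵢ is on its pendant leaf
      spine-covered : ∀ {i} → i < m → ∀ {x} → x ∈ˢ label (spine i) → ∃[ u ] (Adj G (s i) u × x ∈ˢ f u)
      spine-covered {i} i<m x∈ with spine-colours i x∈
      ... | inj₁ refl = zero-covered i<m
      ... | inj₂ x∈pendant with slot-leaf {i} {0} (i<m , leafCount-positive m i)
      ...   | sᵢ~ℓ , code≡ = _ , sᵢ~ℓ , subst (_ ∈ˢ_) (sym (cong label code≡)) x∈pendant

      f-covered : ∀ v {x} → x ∈ˢ f v → ∃[ u ] (Adj G v u × x ∈ˢ f u)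
      f-covered v {x} x∈ = by-cases (v ∈? p)
        where
        by-cases : Dec (v ∈ p) → ∃[ u ] (Adj G v u × x ∈ˢ f u)
        by-cases (no  v∉p) = parent v , parent-adjacent v , f-leaf⊆f-parent v∉p x∈
        by-cases (yes v∈p) with spine-covered (position< p v∈p) (subst (x ∈ˢ_) (f-spine v∈p) x∈)
        ... | u , sᵢ~u , x∈fu = u , subst (λ w → Adj G w u) (s-pos v∈p) sᵢ~u , x∈fu

      strong-royal : HasStrongRoyal G (suc j)
      strong-royal = labelling⇒strong-royal G f f-injective f-meet f-covered

module PowerArithmetic where

  open import Data.Nat using (suc; _+_; _*_; _^_; _∸_; _≤_; _<_; s≤s)
  open import Data.Nat.Properties using (*-cancelˡ-<; +-identityʳ; +-suc; <-irrefl; ≤-<-trans; <-≤-trans; ≮⇒≥; _<?_; ^-monoʳ-≤)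
  open import Data.Empty using (⊥-elim)
  open import Relation.Nullary using (yes; no)
  open import Relation.Binary.PropositionalEquality using (_≡_; refl; sym; trans; cong; subst)

  ≤∸1⇒< : ∀ {a n} → 0 < a → n ≤ a ∸ 1 → n < a
  ≤∸1⇒< {suc a} _ n≤a = s≤s n≤a

  spine-fits : ∀ {m n j} → m + (2 + m) ≤ n → n < 2 ^ suc j → 2 + m ≤ 2 ^ j
  spine-fits {m} {n} {j} 2m+2≤n n<2^j+1 =
    *-cancelˡ-< 2 (suc m) (2 ^ j) (subst (_< 2 ^ suc j) twice (≤-<-trans 2m+2≤n n<2^j+1))
    where
    twice : m + (2 + m) ≡ 2 * suc m
    twice = trans (+-suc m (suc m)) (sym (cong (suc m +_) (+-identityʳ (suc m))))

  exponent-bound : ∀ {j j' n} → 2 ^ j ≤ n → n < 2 ^ j' → j < j'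
  exponent-bound {j} {j'} 2^j≤n n<2^j' with j <? j'
  ... | yes j<j' = j<j'
  ... | no  j≮j' = ⊥-elim (<-irrefl refl (<-≤-trans (≤-<-trans 2^j≤n n<2^j') (^-monoʳ-≤ 2 (≮⇒≥ j≮j'))))

open import Defs
open import Data.Nat using (ℕ; _≤_)
open import Data.Nat using (suc; z≤n; s≤s)
open import Data.Nat.Properties using (m^n>0)
open import Data.Product using (_,_)
open RoyalColourings using (strong-royal-bound)
open Caterpillars using (module CubicCaterpillar)
open PowerArithmetic

-- k = j + 1 colours suffice since m + 2 ≤ 2^j, and fewer colours never do
corollary2p3 : (n : ℕ) (T : Graph n) → 4 ≤ n → IsCubicTree T → IsCaterpillar T → RoyalZero T
corollary2p3 n T n≥4 ((connected , _) , cubic) (_ , p , p-unique , spine⇔ , adjacent⇔) (suc j) _ 2^j≤n n≤2^k-1 =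
  s≤s z≤n , strong-royal , minimal
  where
  open CubicCaterpillar T n≥4 connected cubic p p-unique spine⇔ adjacent⇔
  open Colouring j (spine-fits {j = j} order-bound (≤∸1⇒< (m^n>0 2 (suc j)) n≤2^k-1))
  minimal : ∀ j' → 1 ≤ j' → HasStrongRoyal T j' → suc j ≤ j'
  minimal j' _ royal = exponent-bound 2^j≤n (strong-royal-bound T some-neighbour royal)
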